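{- Every inductively pierced code $\mathcal C$ is intersection-complete: for any $c,d\in\mathcal C$, $c\cap d\in\mathcal C$.
   Context: A neural code on $n$ neurons is a set $\mathcal C\subseteq 2^{[n]}$ of subsets of $[n]$. Piercing: let $\mathcal C$ be a code on $[n]$ and $(\lambda,\sigma,\tau)$ a partition of $[n]$ into three disjoint (possibly empty) sets with $|\lambda|=j$. $\mathcal C$ is $(\lambda,\sigma,\tau)$-pierceable if $\sigma\cup\nu\in\mathcal C$ for every $\nu\subseteq\lambda$; then the $j$-piercing is the code on $[n+1]$ given by $\mathcal C\cup\{\sigma\cup\nu\cup\{n+1\}:\nu\subseteq\lambda\}$. A code is inductively $k$-pierced if it is $\{\varnothing,\{1\}\}$ or is obtained from an inductively $k$-pierced code on $n-1$ neurons by a $j$-piercing with $j\le k$. A code is inductively pierced if it is inductively $k$-pierced for some $k\ge0$. -}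

module Defs where

open import Level using (0ℓ)
open import Data.Nat using (ℕ; zero; suc; _≤_)
open import Data.Bool using (true; false)
open import Data.Vec using ([]; _∷_; _∷ʳ_)
open import Data.Fin.Subset using (Subset; _⊆_; _∪_; _∩_; ∣_∣; Empty)
open import Data.Product using (Σ; _×_)
open import Data.Sum using (_⊎_)
open import Relation.Binary.PropositionalEquality using (_≡_)

Code : ℕ → Set₁
Code n = Subset n → Set

baseCode : Code 1
baseCode c = (c ≡ false ∷ []) ⊎ (c ≡ true ∷ [])

-- (λ,σ,τ) is a partition of [n]: λ and σ disjoint, τ is the complement
-- of λ ∪ σ (hence determined and left implicit).
Disjoint : ∀ {n} → Subset n → Subset n → Set
Disjoint l s = Empty (l ∩ s)

Pierceable : ∀ {n} → Code n → Subset n → Subset n → Set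
Pierceable C l s = ∀ ν → ν ⊆ l → C (s ∪ ν)

-- The piercing: the new neuron n+1 is the last coordinate.
-- Old codewords c ⊆ [n] are viewed as c ⊆ [n+1] (last bit false);
-- the new codewords are σ ∪ ν ∪ {n+1} for ν ⊆ λ.
piercing : ∀ {n} → Code n → Subset n → Subset n → Code (suc n)
piercing C l s c =
  (Σ (Subset _) λ c' → C c' × (c ≡ c' ∷ʳ false))
  ⊎ (Σ (Subset _) λ ν → ν ⊆ l × (c ≡ (s ∪ ν) ∷ʳ true))

data InductivelyKPierced (k : ℕ) : (n : ℕ) → Code n → Set₁ where
  base   : InductivelyKPierced k 1 baseCode
  pierce : ∀ {n} {C : Code n} (l s : Subset n) →
           InductivelyKPierced k n C →
           Disjoint l s →
           ∣ l ∣ ≤ k →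
           Pierceable C l s →
           InductivelyKPierced k (suc n) (piercing C l s)

InductivelyPierced : (n : ℕ) → Code n → Set₁
InductivelyPierced n C = Σ ℕ λ k → InductivelyKPierced k n C

IntersectionComplete : ∀ {n} → Code n → Set
IntersectionComplete C = ∀ c d → C c → C d → C (c ∩ d)

-- Intersection-completeness holds for {∅, {1}} and is preserved by every
-- piercing of a pierceable code: two new codewords σ ∪ ν ∪ {n+1} and
-- σ ∪ μ ∪ {n+1} meet in σ ∪ (ν ∩ μ) ∪ {n+1}, again a new codeword, and
-- every other intersection has last bit false and is the intersection of
-- two old codewords (pierceability makes σ ∪ ν one of them).
module Submission where

open import Defs
open import Data.Nat using (ℕ)
open import Data.Bool using (Bool; true; false; _∧_)
open import Data.Vec using ([]; _∷_; _∷ʳ_)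
open import Data.Fin.Subset using (Subset; _∪_; _∩_)
open import Data.Fin.Subset.Properties using (p∩q⊆p; ∪-distribˡ-∩)
open import Data.Product using (_,_)
open import Data.Sum using (inj₁; inj₂)
open import Relation.Binary.PropositionalEquality using (_≡_; refl; cong; sym; trans)

∩-∷ʳ : ∀ {n} (x y : Subset n) (a b : Bool) → (x ∷ʳ a) ∩ (y ∷ʳ b) ≡ (x ∩ y) ∷ʳ (a ∧ b)
∩-∷ʳ []      []      a b = refl
∩-∷ʳ (p ∷ x) (q ∷ y) a b = cong ((p ∧ q) ∷_) (∩-∷ʳ x y a b)

baseCode-intersectionComplete : IntersectionComplete baseCode
baseCode-intersectionComplete _ _ (inj₁ refl) (inj₁ refl) = inj₁ refl
baseCode-intersectionComplete _ _ (inj₁ refl) (inj₂ refl) = inj₁ refl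
baseCode-intersectionComplete _ _ (inj₂ refl) (inj₁ refl) = inj₁ refl
baseCode-intersectionComplete _ _ (inj₂ refl) (inj₂ refl) = inj₂ refl

piercing-intersectionComplete : ∀ {n} {C : Code n} {l s : Subset n} →
  Pierceable C l s → IntersectionComplete C → IntersectionComplete (piercing C l s)
piercing-intersectionComplete {l = l} {s} pc ic = go
  where
  go : IntersectionComplete (piercing _ l s)
  go _ _ (inj₁ (c , c∈C , refl)) (inj₁ (d , d∈C , refl)) =
    inj₁ (c ∩ d , ic c d c∈C d∈C , ∩-∷ʳ c d false false)
  go _ _ (inj₁ (c , c∈C , refl)) (inj₂ (ν , ν⊆l , refl)) =
    inj₁ (c ∩ (s ∪ ν) , ic c (s ∪ ν) c∈C (pc ν ν⊆l) , ∩-∷ʳ c (s ∪ ν) false true)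
  go _ _ (inj₂ (ν , ν⊆l , refl)) (inj₁ (d , d∈C , refl)) =
    inj₁ ((s ∪ ν) ∩ d , ic (s ∪ ν) d (pc ν ν⊆l) d∈C , ∩-∷ʳ (s ∪ ν) d true false)
  go _ _ (inj₂ (ν , ν⊆l , refl)) (inj₂ (μ , _ , refl)) =
    inj₂ (ν ∩ μ , (λ x∈ν∩μ → ν⊆l (p∩q⊆p ν μ x∈ν∩μ)) ,
          trans (∩-∷ʳ (s ∪ ν) (s ∪ μ) true true)
                (cong (_∷ʳ true) (sym (∪-distribˡ-∩ s ν μ))))

inductivelyKPierced⇒intersectionComplete : ∀ {k n} {C : Code n} →
  InductivelyKPierced k n C → IntersectionComplete C
inductivelyKPierced⇒intersectionComplete base = baseCode-intersectionComplete
inductivelyKPierced⇒intersectionComplete (pierce _ _ p _ _ pc) =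
  piercing-intersectionComplete pc (inductivelyKPierced⇒intersectionComplete p)

mainTheorem2 : (n : ℕ) (C : Code n) → InductivelyPierced n C → IntersectionComplete C
mainTheorem2 n C (k , p) = inductivelyKPierced⇒intersectionComplete p
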